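{- Let $p<q$ be primes and $1\le l\le p+q-1$ an integer. Suppose $\mu,\lambda$ are integers with $1\le \mu\le q$, $1\le\lambda\le p$ and $pq-p-q+l=(\mu-1)p+(\lambda-1)q$ (equivalently $pq+l=\mu p+\lambda q$). Then $$(1+x+\dots+x^{l-1})\Phi_{pq}(x)=(1+x^p+\dots+x^{p(\mu-1)})(1+x^q+\dots+x^{q(\lambda-1)})-x^l(1+x^p+\dots+x^{p(q-\mu-1)})(1+x^q+\dots+x^{q(p-\lambda-1)}).$$
   Context: $\Phi_{pq}(x)$ is the $pq$th cyclotomic polynomial. A geometric sum $1+x^a+\dots+x^{a(m-1)}$ with $m=0$ terms is interpreted as $0$. -}

module Defs where

open import Data.Nat as ℕ using (ℕ; zero; suc)
open import Data.Nat.Divisibility using (_∣?_)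
open import Data.Integer as ℤ using (ℤ; 0ℤ; 1ℤ)
open import Data.List using (List; []; _∷_; filter; map; foldr; upTo; replicate; drop)

-- Polynomials over ℤ as coefficient lists, lowest degree first.
Poly : Set
Poly = List ℤ

coeff : Poly → ℕ → ℤ
coeff []       _       = 0ℤ
coeff (a ∷ f)  zero    = a
coeff (a ∷ f)  (suc i) = coeff f i

-- equality of polynomials: all coefficients agree (ignores trailing zeros)
infix 4 _≈_
_≈_ : Poly → Poly → Set
f ≈ g = ∀ i → coeff f i ≡ coeff g i
  where open import Relation.Binary.PropositionalEquality using (_≡_)

infixl 6 _+ₚ_ _-ₚ_
infixl 7 _*ₚ_ _·_

_+ₚ_ : Poly → Poly → Poly
[]      +ₚ g       = g
f       +ₚ []      = f
(a ∷ f) +ₚ (b ∷ g) = (a ℤ.+ b) ∷ (f +ₚ g)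

-ₚ_ : Poly → Poly
-ₚ f = map ℤ.-_ f

_-ₚ_ : Poly → Poly → Poly
f -ₚ g = f +ₚ (-ₚ g)

_·_ : ℤ → Poly → Poly
c · f = map (c ℤ.*_) f

_*ₚ_ : Poly → Poly → Poly
[]      *ₚ g = []
(a ∷ f) *ₚ g = (a · g) +ₚ (0ℤ ∷ (f *ₚ g))

oneₚ : Poly
oneₚ = 1ℤ ∷ []

X^ : ℕ → Poly
X^ n = Data.List._++_ (replicate n 0ℤ) (1ℤ ∷ [])

prodₚ : List Poly → Poly
prodₚ = foldr _*ₚ_ oneₚ

sumₚ : List Poly → Poly
sumₚ = foldr _+ₚ_ []

geom : ℕ → ℕ → Poly
geom a m = sumₚ (map (λ i → X^ (a ℕ.* i)) (upTo m))

divisors : ℕ → List ℕ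
divisors n = filter (_∣? n) (drop 1 (upTo (suc n)))

-- Φ is the family of cyclotomic polynomials: for every n ≥ 1,
-- x^n - 1 = ∏_{d ∣ n} Φ_d  (this determines Φ_n uniquely in ℤ[x]).
IsCyclotomicFamily : (ℕ → Poly) → Set
IsCyclotomicFamily Φ =
  ∀ n → 1 ℕ.≤ n → prodₚ (map Φ (divisors n)) ≈ (X^ n -ₚ oneₚ)

module Submission where

-- Work in ℤ[[x]], where every x ^ n - 1 with n ≥ 1 is cancellable, and multiply both sides by
-- (x ^ p - 1)(x ^ q - 1). The divisor lists of 1, p, q and pq turn the cyclotomic hypothesis into
-- (x ^ p - 1)(x ^ q - 1) Φ_pq = (x - 1)(x ^ pq - 1), so the left side becomes (x ^ l - 1)(x ^ pq - 1).
-- On the right every geometric sum telescopes; with u = x ^ (p(q - μ)) and v = x ^ (q(p - λ)) the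
-- relations pμ = l + q(p - λ) and qλ = l + p(q - μ) turn it into
-- (x ^ l v - 1)(x ^ l u - 1) - x ^ l (u - 1)(v - 1) = (x ^ l - 1)(x ^ l u v - 1),
-- and l + p(q - μ) + q(p - λ) = pq.

open import Defs
open import Data.Nat using (ℕ; zero; suc)
open import Relation.Binary.PropositionalEquality

module FormalSeries where

  open import Algebra.Bundles using (CommutativeRing)
  import Algebra.Construct.Pointwise as Pointwise
  open import Data.Integer using (ℤ; 0ℤ; 1ℤ; _+_; _*_; -_; _-_)
  import Data.Integer.Properties as ℤ
  open import Data.Integer.Solver using (module +-*-Solver)
  open import Data.List using (List; _∷_; []; _∷ʳ_; map; foldr; upTo; applyUpTo)
  open import Data.List.Properties using (map-upTo; applyUpTo-∷ʳ)
  import Data.Nat as ℕ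
  open import Data.Nat.Induction using (<-rec)
  import Data.Nat.Properties as ℕ
  open import Data.Product using (_,_)
  open import Function using (_∘_)
  open import Level using (0ℓ)

  open import Algebra.Properties.AbelianGroup ℤ.+-0-abelianGroup using (∙-cancelˡ)
  open +-*-Solver using (solve; _:=_; _:+_; _:*_)

  Series : Set
  Series = ℕ → ℤ

  infixl 6 _+ˢ_ _-ˢ_
  infixl 7 _*ˢ_ _·ˢ_
  infix  8 -ˢ_

  _+ˢ_ : Series → Series → Series
  (f +ˢ g) i = f i + g i

  -ˢ_ : Series → Series
  (-ˢ f) i = - f i

  _-ˢ_ : Series → Series → Series
  f -ˢ g = f +ˢ -ˢ g

  _·ˢ_ : ℤ → Series → Series
  (c ·ˢ f) i = c * f i

  0ˢ : Series
  0ˢ _ = 0ℤ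

  constant : ℤ → Series
  constant c zero    = c
  constant c (suc _) = 0ℤ

  1ˢ : Series
  1ˢ = constant 1ℤ

  tail : Series → Series
  tail f i = f (suc i)

  -- Cauchy product, by the recursion f = f 0 + x · tail f.
  _*ˢ_ : Series → Series → Series
  (f *ˢ g) zero    = f 0 * g 0
  (f *ˢ g) (suc n) = f 0 * g (suc n) + (tail f *ˢ g) n

  *ˢ-cong : ∀ {f f′ g g′} → f ≗ f′ → g ≗ g′ → f *ˢ g ≗ f′ *ˢ g′
  *ˢ-cong f≗f′ g≗g′ zero    = cong₂ _*_ (f≗f′ 0) (g≗g′ 0)
  *ˢ-cong f≗f′ g≗g′ (suc n) =
    cong₂ _+_ (cong₂ _*_ (f≗f′ 0) (g≗g′ (suc n))) (*ˢ-cong (f≗f′ ∘ suc) g≗g′ n)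

  *ˢ-zeroˡ : ∀ g → 0ˢ *ˢ g ≗ 0ˢ
  *ˢ-zeroˡ g zero    = ℤ.*-zeroˡ (g 0)
  *ˢ-zeroˡ g (suc n) = cong₂ _+_ (ℤ.*-zeroˡ (g (suc n))) (*ˢ-zeroˡ g n)

  *ˢ-identityˡ : ∀ g → 1ˢ *ˢ g ≗ g
  *ˢ-identityˡ g zero    = ℤ.*-identityˡ (g 0)
  *ˢ-identityˡ g (suc n) =
    trans (cong₂ _+_ (ℤ.*-identityˡ (g (suc n))) (*ˢ-zeroˡ g n)) (ℤ.+-identityʳ (g (suc n)))

  *ˢ-distribʳ-+ˢ : ∀ h f g → (f +ˢ g) *ˢ h ≗ f *ˢ h +ˢ g *ˢ h
  *ˢ-distribʳ-+ˢ h f g zero    = ℤ.*-distribʳ-+ (h 0) (f 0) (g 0)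
  *ˢ-distribʳ-+ˢ h f g (suc n) =
    trans (cong ((f 0 + g 0) * h (suc n) +_) (*ˢ-distribʳ-+ˢ h (tail f) (tail g) n))
          (solve 5 (λ a b c u v → (a :+ b) :* c :+ (u :+ v) := (a :* c :+ u) :+ (b :* c :+ v))
                 refl (f 0) (g 0) (h (suc n)) ((tail f *ˢ h) n) ((tail g *ˢ h) n))

  *ˢ-assoc-·ˢ : ∀ c f g → (c ·ˢ f) *ˢ g ≗ c ·ˢ (f *ˢ g)
  *ˢ-assoc-·ˢ c f g zero    = ℤ.*-assoc c (f 0) (g 0)
  *ˢ-assoc-·ˢ c f g (suc n) =
    trans (cong (c * f 0 * g (suc n) +_) (*ˢ-assoc-·ˢ c (tail f) g n))
          (solve 4 (λ c a b u → c :* a :* b :+ c :* u := c :* (a :* b :+ u))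
                 refl c (f 0) (g (suc n)) ((tail f *ˢ g) n))

  *ˢ-comm : ∀ f g → f *ˢ g ≗ g *ˢ f
  *ˢ-comm f g zero          = ℤ.*-comm (f 0) (g 0)
  *ˢ-comm f g (suc zero)    =
    solve 4 (λ a b c d → a :* b :+ c :* d := d :* c :+ b :* a) refl (f 0) (g 1) (f 1) (g 0)
  *ˢ-comm f g (suc (suc n)) = begin
    f 0 * g₂ + (tail f *ˢ g) (suc n)
      ≡⟨ cong (f 0 * g₂ +_) (*ˢ-comm (tail f) g (suc n)) ⟩
    f 0 * g₂ + (g 0 * f₂ + (tail g *ˢ tail f) n)
      ≡⟨ solve 3 (λ a b u → a :+ (b :+ u) := b :+ (a :+ u)) refl (f 0 * g₂) (g 0 * f₂) _ ⟩
    g 0 * f₂ + (f 0 * g₂ + (tail g *ˢ tail f) n)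
      ≡⟨ cong (λ t → g 0 * f₂ + (f 0 * g₂ + t)) (*ˢ-comm (tail g) (tail f) n) ⟩
    g 0 * f₂ + (f *ˢ tail g) (suc n)
      ≡⟨ cong (g 0 * f₂ +_) (*ˢ-comm f (tail g) (suc n)) ⟩
    g 0 * f₂ + (tail g *ˢ f) (suc n) ∎
    where
    open ≡-Reasoning
    f₂ = f (suc (suc n))
    g₂ = g (suc (suc n))

  *ˢ-assoc : ∀ f g h → (f *ˢ g) *ˢ h ≗ f *ˢ (g *ˢ h)
  *ˢ-assoc f g h zero    = ℤ.*-assoc (f 0) (g 0) (h 0)
  *ˢ-assoc f g h (suc n) = begin
    f 0 * g 0 * h (suc n) + ((f 0 ·ˢ tail g +ˢ tail f *ˢ g) *ˢ h) n
      ≡⟨ cong (f 0 * g 0 * h (suc n) +_) (*ˢ-distribʳ-+ˢ h (f 0 ·ˢ tail g) (tail f *ˢ g) n) ⟩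
    f 0 * g 0 * h (suc n) + (((f 0 ·ˢ tail g) *ˢ h) n + ((tail f *ˢ g) *ˢ h) n)
      ≡⟨ cong (f 0 * g 0 * h (suc n) +_)
              (cong₂ _+_ (*ˢ-assoc-·ˢ (f 0) (tail g) h n) (*ˢ-assoc (tail f) g h n)) ⟩
    f 0 * g 0 * h (suc n) + (f 0 * (tail g *ˢ h) n + (tail f *ˢ (g *ˢ h)) n)
      ≡⟨ solve 5 (λ a b c u v → a :* b :* c :+ (a :* u :+ v) := a :* (b :* c :+ u) :+ v)
               refl (f 0) (g 0) (h (suc n)) _ _ ⟩
    f 0 * (g 0 * h (suc n) + (tail g *ˢ h) n) + (tail f *ˢ (g *ˢ h)) n ∎
    where open ≡-Reasoning

  *ˢ-identityʳ : ∀ f → f *ˢ 1ˢ ≗ f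
  *ˢ-identityʳ f i = trans (*ˢ-comm f 1ˢ i) (*ˢ-identityˡ f i)

  *ˢ-distribˡ-+ˢ : ∀ h f g → h *ˢ (f +ˢ g) ≗ h *ˢ f +ˢ h *ˢ g
  *ˢ-distribˡ-+ˢ h f g i = begin
    (h *ˢ (f +ˢ g)) i        ≡⟨ *ˢ-comm h (f +ˢ g) i ⟩
    ((f +ˢ g) *ˢ h) i        ≡⟨ *ˢ-distribʳ-+ˢ h f g i ⟩
    (f *ˢ h) i + (g *ˢ h) i  ≡⟨ cong₂ _+_ (*ˢ-comm f h i) (*ˢ-comm g h i) ⟩
    (h *ˢ f) i + (h *ˢ g) i  ∎
    where open ≡-Reasoning

  seriesRing : CommutativeRing 0ℓ 0ℓ
  seriesRing = record
    { Carrier = Series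
    ; _≈_ = _≗_
    ; _+_ = _+ˢ_
    ; _*_ = _*ˢ_
    ; -_ = -ˢ_
    ; 0# = 0ˢ
    ; 1# = 1ˢ
    ; isCommutativeRing = record
      { isRing = record
        { +-isAbelianGroup = Pointwise.isAbelianGroup ℕ ℤ.+-0-isAbelianGroup
        ; *-cong = *ˢ-cong
        ; *-assoc = *ˢ-assoc
        ; *-identity = *ˢ-identityˡ , *ˢ-identityʳ
        ; distrib = *ˢ-distribˡ-+ˢ , *ˢ-distribʳ-+ˢ
        }
      ; *-comm = *ˢ-comm
      }
    }

  shift : ℕ → Series → Series
  shift zero    f         = f
  shift (suc k) f zero    = 0ℤ
  shift (suc k) f (suc i) = shift k f i

  Xˢ^_ : ℕ → Series
  Xˢ^ k = shift k 1ˢ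

  shift-*ˢ : ∀ k f g → shift k f *ˢ g ≗ shift k (f *ˢ g)
  shift-*ˢ zero    f g i       = refl
  shift-*ˢ (suc k) f g zero    = ℤ.*-zeroˡ (g 0)
  shift-*ˢ (suc k) f g (suc i) =
    trans (cong₂ _+_ (ℤ.*-zeroˡ (g (suc i))) (shift-*ˢ k f g i)) (ℤ.+-identityˡ _)

  Xˢ^-*ˢ : ∀ k g → Xˢ^ k *ˢ g ≗ shift k g
  Xˢ^-*ˢ k g i = trans (shift-*ˢ k 1ˢ g i) (shift-cong k (*ˢ-identityˡ g) i)
    where
    shift-cong : ∀ k {f g} → f ≗ g → shift k f ≗ shift k g
    shift-cong zero    f≗g i       = f≗g i
    shift-cong (suc k) f≗g zero    = refl
    shift-cong (suc k) f≗g (suc i) = shift-cong k f≗g i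

  shift-shift : ∀ m n f → shift m (shift n f) ≗ shift (m ℕ.+ n) f
  shift-shift zero    n f i       = refl
  shift-shift (suc m) n f zero    = refl
  shift-shift (suc m) n f (suc i) = shift-shift m n f i

  Xˢ^-+ : ∀ m n → Xˢ^ (m ℕ.+ n) ≗ Xˢ^ m *ˢ Xˢ^ n
  Xˢ^-+ m n i = sym (trans (Xˢ^-*ˢ m (Xˢ^ n) i) (shift-shift m n 1ˢ i))

  shift-cong-below : ∀ k {f g} i → (∀ {j} → j ℕ.< i → f j ≡ g j) →
                     shift (suc k) f i ≡ shift (suc k) g i
  shift-cong-below k       zero    _   = refl
  shift-cong-below zero    (suc i) f≡g = f≡g (ℕ.n<1+n i)
  shift-cong-below (suc k) (suc i) f≡g = shift-cong-below k i (f≡g ∘ ℕ.m<n⇒m<1+n)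

  shift-difference-injective : ∀ k {f g} →
    (∀ i → shift (suc k) f i - f i ≡ shift (suc k) g i - g i) → f ≗ g
  shift-difference-injective k {f} {g} eq = <-rec (λ i → f i ≡ g i) step
    where
    step : ∀ i → (∀ {j} → j ℕ.< i → f j ≡ g j) → f i ≡ g i
    step i f≡g = ℤ.neg-injective (∙-cancelˡ (shift (suc k) f i) _ _
      (trans (eq i) (cong (_- g i) (sym (shift-cong-below k i f≡g)))))

  coeff-+ₚ : ∀ f g → coeff (f +ₚ g) ≗ coeff f +ˢ coeff g
  coeff-+ₚ []      g       i       = sym (ℤ.+-identityˡ _)
  coeff-+ₚ (a ∷ f) []      i       = sym (ℤ.+-identityʳ _)
  coeff-+ₚ (a ∷ f) (b ∷ g) zero    = refl
  coeff-+ₚ (a ∷ f) (b ∷ g) (suc i) = coeff-+ₚ f g i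

  coeff-negₚ : ∀ f → coeff (-ₚ f) ≗ -ˢ coeff f
  coeff-negₚ []      i       = refl
  coeff-negₚ (a ∷ f) zero    = refl
  coeff-negₚ (a ∷ f) (suc i) = coeff-negₚ f i

  coeff--ₚ : ∀ f g → coeff (f -ₚ g) ≗ coeff f -ˢ coeff g
  coeff--ₚ f g i = trans (coeff-+ₚ f (-ₚ g) i) (cong (coeff f i +_) (coeff-negₚ g i))

  coeff-· : ∀ c f → coeff (c · f) ≗ c ·ˢ coeff f
  coeff-· c []      i       = sym (ℤ.*-zeroʳ c)
  coeff-· c (a ∷ f) zero    = refl
  coeff-· c (a ∷ f) (suc i) = coeff-· c f i

  coeff-*ₚ : ∀ f g → coeff (f *ₚ g) ≗ coeff f *ˢ coeff g
  coeff-*ₚ []      g i       = sym (*ˢ-zeroˡ (coeff g) i)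
  coeff-*ₚ (a ∷ f) g zero    =
    trans (coeff-+ₚ (a · g) (0ℤ ∷ f *ₚ g) 0) (trans (ℤ.+-identityʳ _) (coeff-· a g 0))
  coeff-*ₚ (a ∷ f) g (suc i) =
    trans (coeff-+ₚ (a · g) (0ℤ ∷ f *ₚ g) (suc i)) (cong₂ _+_ (coeff-· a g (suc i)) (coeff-*ₚ f g i))

  coeff-X^ : ∀ n → coeff (X^ n) ≗ Xˢ^ n
  coeff-X^ zero    zero    = refl
  coeff-X^ zero    (suc i) = refl
  coeff-X^ (suc n) zero    = refl
  coeff-X^ (suc n) (suc i) = coeff-X^ n i

  coeff-oneₚ : coeff oneₚ ≗ 1ˢ
  coeff-oneₚ = coeff-X^ 0

  productˢ : List Series → Series
  productˢ = foldr _*ˢ_ 1ˢ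

  coeff-prodₚ : ∀ fs → coeff (prodₚ fs) ≗ productˢ (map coeff fs)
  coeff-prodₚ []       = coeff-oneₚ
  coeff-prodₚ (f ∷ fs) i = trans (coeff-*ₚ f (prodₚ fs) i) (*ˢ-cong (λ _ → refl) (coeff-prodₚ fs) i)

  coeff-sumₚ-∷ʳ : ∀ fs g → coeff (sumₚ (fs ∷ʳ g)) ≗ coeff (sumₚ fs) +ˢ coeff g
  coeff-sumₚ-∷ʳ []       g i = trans (coeff-+ₚ g [] i) (ℤ.+-comm (coeff g i) 0ℤ)
  coeff-sumₚ-∷ʳ (f ∷ fs) g i = begin
    coeff (f +ₚ sumₚ (fs ∷ʳ g)) i                      ≡⟨ coeff-+ₚ f (sumₚ (fs ∷ʳ g)) i ⟩
    coeff f i + coeff (sumₚ (fs ∷ʳ g)) i               ≡⟨ cong (coeff f i +_) (coeff-sumₚ-∷ʳ fs g i) ⟩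
    coeff f i + (coeff (sumₚ fs) i + coeff g i)        ≡⟨ ℤ.+-assoc (coeff f i) _ _ ⟨
    coeff f i + coeff (sumₚ fs) i + coeff g i          ≡⟨ cong (_+ coeff g i) (coeff-+ₚ f (sumₚ fs) i) ⟨
    coeff (f +ₚ sumₚ fs) i + coeff g i                 ∎
    where open ≡-Reasoning

  geomˢ : ℕ → ℕ → Series
  geomˢ a m = coeff (geom a m)

  coeff-geom-suc : ∀ a m → geomˢ a (suc m) ≗ geomˢ a m +ˢ Xˢ^ (a ℕ.* m)
  coeff-geom-suc a m i = begin
    coeff (sumₚ (map term (upTo (suc m)))) i
      ≡⟨ cong (λ fs → coeff (sumₚ fs) i) (trans (map-upTo term (suc m)) (sym (applyUpTo-∷ʳ term m))) ⟩
    coeff (sumₚ (applyUpTo term m ∷ʳ term m)) i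
      ≡⟨ coeff-sumₚ-∷ʳ (applyUpTo term m) (term m) i ⟩
    coeff (sumₚ (applyUpTo term m)) i + coeff (term m) i
      ≡⟨ cong₂ _+_ (cong (λ fs → coeff (sumₚ fs) i) (sym (map-upTo term m))) (coeff-X^ (a ℕ.* m) i) ⟩
    geomˢ a m i + (Xˢ^ (a ℕ.* m)) i ∎
    where
    open ≡-Reasoning
    term : ℕ → Poly
    term j = X^ (a ℕ.* j)

open FormalSeries

-- ℤ rather than the series themselves serves as coefficient ring, so that numerals in normal forms compute.
module SeriesSolver where

  open import Algebra.Solver.Ring.AlmostCommutativeRing
    using (fromCommutativeRing; _-Raw-AlmostCommutative⟶_)
  open import Data.Integer using (_+_; +-*-rawRing)
  open import Data.Integer.Properties using (_≟_; *-zeroʳ)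
  open import Data.Maybe using (Maybe; map)
  open import Relation.Nullary.Decidable using (dec⇒maybe)

  constant-homomorphism : +-*-rawRing -Raw-AlmostCommutative⟶ fromCommutativeRing seriesRing
  constant-homomorphism = record
    { ⟦_⟧    = constant
    ; +-homo = λ { a b zero → refl ; a b (suc i) → refl }
    ; *-homo = λ { a b zero → refl
                 ; a b (suc i) → sym (cong₂ _+_ (*-zeroʳ a) (*ˢ-zeroˡ (constant b) i)) }
    ; -‿homo = λ { a zero → refl ; a (suc i) → refl }
    ; 0-homo = λ { zero → refl ; (suc i) → refl }
    ; 1-homo = λ _ → refl
    }

  constant-≟ : ∀ a b → Maybe (constant a ≗ constant b)
  constant-≟ a b = map (λ { refl _ → refl }) (dec⇒maybe (a ≟ b))

  open import Algebra.Solver.Ring +-*-rawRing (fromCommutativeRing seriesRing) constant-homomorphism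
    constant-≟ public

open import Algebra.Bundles using (CommutativeRing)
open import Data.Integer using (1ℤ)
open import Data.List using (List; []; _∷_; map; filter; applyUpTo)
open import Data.List.Membership.Propositional using (_∈_)
open import Data.List.Relation.Unary.All as All using (All; []; _∷_)
open import Data.List.Relation.Unary.AllPairs using (AllPairs; []; _∷_)
open import Data.List.Relation.Unary.Any using (here; there)
open import Data.Nat using (_+_; _*_; _∸_; _≤_; _<_; s≤s; z≤n; NonZero)
open import Data.Nat.Base using (nonTrivial⇒n>1; ≢-nonZero⁻¹; >-nonZero⁻¹)
open import Data.Nat.Coprimality using (Coprime; coprime-divisor)
open import Data.Nat.Divisibility
  using (_∣_; _∣?_; divides; ∣-refl; 1∣_; m∣m*n; n∣m*n; ∣⇒≤; 0∣⇒≡0; *-cancelˡ-∣)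
open import Data.Nat.Primality using (Prime; prime⇒nonZero; prime⇒nonTrivial; prime⇒irreducible)
import Data.Nat.Properties as ℕ
open import Data.Nat.Tactic.RingSolver using (solve-∀)
open import Data.Product using (_×_; _,_)
open import Data.Sum using (inj₁; inj₂)
open import Function using (_∘_)
import Relation.Binary.Reasoning.Setoid as SetoidReasoning
open import Relation.Nullary using (yes; no; contradiction)
open import Relation.Unary using (Pred; Decidable)

open SeriesSolver using (solve; _:=_; _:+_; _:-_; _:*_; con)
open CommutativeRing seriesRing using (zeroʳ; -‿inverseʳ)
  renaming (+-cong to +ˢ-cong; -‿cong to -ˢ-cong; refl to ≗-refl; trans to ≗-trans)

module ≗-Reasoning = SetoidReasoning (CommutativeRing.setoid seriesRing)

Xˢ^-1-*ˢ : ∀ k f → (Xˢ^ k -ˢ 1ˢ) *ˢ f ≗ shift k f -ˢ f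
Xˢ^-1-*ˢ k f = begin
  (Xˢ^ k -ˢ 1ˢ) *ˢ f  ≈⟨ solve 2 (λ x f → (x :- con 1ℤ) :* f := x :* f :- f) ≗-refl (Xˢ^ k) f ⟩
  Xˢ^ k *ˢ f -ˢ f     ≈⟨ +ˢ-cong (Xˢ^-*ˢ k f) ≗-refl ⟩
  shift k f -ˢ f      ∎
  where open ≗-Reasoning

Xˢ^-1-cancelˡ : ∀ k .{{_ : NonZero k}} {f g} →
  (Xˢ^ k -ˢ 1ˢ) *ˢ f ≗ (Xˢ^ k -ˢ 1ˢ) *ˢ g → f ≗ g
Xˢ^-1-cancelˡ (suc k) {f} {g} eq = shift-difference-injective k λ i →
  trans (sym (Xˢ^-1-*ˢ (suc k) f i)) (trans (eq i) (Xˢ^-1-*ˢ (suc k) g i))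

geom-telescope : ∀ a m → (Xˢ^ a -ˢ 1ˢ) *ˢ geomˢ a m ≗ Xˢ^ (a * m) -ˢ 1ˢ
geom-telescope a zero = begin
  (Xˢ^ a -ˢ 1ˢ) *ˢ 0ˢ  ≈⟨ zeroʳ (Xˢ^ a -ˢ 1ˢ) ⟩
  0ˢ                   ≈⟨ -‿inverseʳ 1ˢ ⟨
  Xˢ^ 0 -ˢ 1ˢ          ≡⟨ cong (λ n → Xˢ^ n -ˢ 1ˢ) (ℕ.*-zeroʳ a) ⟨
  Xˢ^ (a * 0) -ˢ 1ˢ    ∎
  where open ≗-Reasoning
geom-telescope a (suc m) = begin
  (Xˢ^ a -ˢ 1ˢ) *ˢ geomˢ a (suc m)
    ≈⟨ *ˢ-cong ≗-refl (coeff-geom-suc a m) ⟩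
  (Xˢ^ a -ˢ 1ˢ) *ˢ (geomˢ a m +ˢ Xˢ^ (a * m))
    ≈⟨ solve 3 (λ x g y → (x :- con 1ℤ) :* (g :+ y) := (x :- con 1ℤ) :* g :+ x :* y :- y)
             ≗-refl (Xˢ^ a) (geomˢ a m) (Xˢ^ (a * m)) ⟩
  (Xˢ^ a -ˢ 1ˢ) *ˢ geomˢ a m +ˢ Xˢ^ a *ˢ Xˢ^ (a * m) -ˢ Xˢ^ (a * m)
    ≈⟨ +ˢ-cong (+ˢ-cong (geom-telescope a m) ≗-refl) ≗-refl ⟩
  Xˢ^ (a * m) -ˢ 1ˢ +ˢ Xˢ^ a *ˢ Xˢ^ (a * m) -ˢ Xˢ^ (a * m)
    ≈⟨ solve 2 (λ x y → y :- con 1ℤ :+ x :* y :- y := x :* y :- con 1ℤ) ≗-refl (Xˢ^ a) (Xˢ^ (a * m)) ⟩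
  Xˢ^ a *ˢ Xˢ^ (a * m) -ˢ 1ˢ
    ≈⟨ +ˢ-cong (Xˢ^-+ a (a * m)) ≗-refl ⟨
  Xˢ^ (a + a * m) -ˢ 1ˢ
    ≡⟨ cong (λ n → Xˢ^ n -ˢ 1ˢ) (ℕ.*-suc a m) ⟨
  Xˢ^ (a * suc m) -ˢ 1ˢ ∎
  where open ≗-Reasoning

interval : ℕ → ℕ → List ℕ
interval a zero    = []
interval a (suc k) = a ∷ interval (suc a) k

applyUpTo≡interval : ∀ f a k → (∀ i → f i ≡ a + i) → applyUpTo f k ≡ interval a k
applyUpTo≡interval f a zero    f≡a+ = refl
applyUpTo≡interval f a (suc k) f≡a+ =
  cong₂ _∷_ (trans (f≡a+ 0) (ℕ.+-identityʳ a))
            (applyUpTo≡interval (f ∘ suc) (suc a) k (λ i → trans (f≡a+ (suc i)) (ℕ.+-suc a i)))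

private
  shift-bound : ∀ {a k d} → d < a + suc k → d < suc a + k
  shift-bound {a} {k} {d} = subst (d <_) (ℕ.+-suc a k)

  unshift-bound : ∀ {a k d} → d < suc a + k → d < a + suc k
  unshift-bound {a} {k} {d} = subst (d <_) (sym (ℕ.+-suc a k))

module _ {p} {P : Pred ℕ p} (P? : Decidable P) where

  filter-interval : ∀ a k {ds} → AllPairs _<_ ds → All (a ≤_) ds → All (_< a + k) ds → All P ds →
                    (∀ {d} → a ≤ d → d < a + k → P d → d ∈ ds) → filter P? (interval a k) ≡ ds
  filter-interval a zero    {[]}    _ _ _ _ _ = refl
  filter-interval a zero    {_ ∷ _} _ (a≤d ∷ _) (d<a+0 ∷ _) _ _ =
    contradiction (subst (_ <_) (ℕ.+-identityʳ a) d<a+0) (ℕ.≤⇒≯ a≤d)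
  filter-interval a (suc k) {ds} sorted lower upper holds complete with P? a
  ... | no ¬Pa =
    filter-interval (suc a) k sorted (All.zipWith a<d (lower , holds)) (All.map shift-bound upper) holds
      λ a<e e<a+k Pe → complete (ℕ.<⇒≤ a<e) (unshift-bound e<a+k) Pe
    where
    a<d : ∀ {d} → a ≤ d × P d → a < d
    a<d (a≤d , Pd) = ℕ.≤∧≢⇒< a≤d λ { refl → ¬Pa Pd }
  filter-interval a (suc k) {[]} _ _ _ _ complete | yes Pa
    with () ← complete ℕ.≤-refl (ℕ.m<m+n a (s≤s z≤n)) Pa
  filter-interval a (suc k) {d ∷ ds} (d<ds ∷ sorted) (a≤d ∷ _) (_ ∷ upper) (_ ∷ holds) complete | yes Pa
    with complete ℕ.≤-refl (ℕ.m<m+n a (s≤s z≤n)) Pa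
  ... | here refl = cong (a ∷_) (filter-interval (suc a) k sorted d<ds (All.map shift-bound upper) holds
      λ a<e e<a+k Pe → tail-member a<e (complete (ℕ.<⇒≤ a<e) (unshift-bound e<a+k) Pe))
    where
    tail-member : ∀ {e} → a < e → e ∈ a ∷ ds → e ∈ ds
    tail-member a<e (here refl) = contradiction a<e (ℕ.n≮n a)
    tail-member a<e (there e∈ds) = e∈ds
  ... | there a∈ds = contradiction (All.lookup d<ds a∈ds) (ℕ.≤⇒≯ a≤d)

∣⇒1≤ : ∀ {d n} .{{_ : NonZero n}} → d ∣ n → 1 ≤ d
∣⇒1≤ {zero}  {n} 0∣n = contradiction (0∣⇒≡0 0∣n) (≢-nonZero⁻¹ n)
∣⇒1≤ {suc d} _       = s≤s z≤n

divisors≡ : ∀ n .{{_ : NonZero n}} {ds} → AllPairs _<_ ds → All (_∣ n) ds →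
            (∀ {d} → d ∣ n → d ∈ ds) → divisors n ≡ ds
divisors≡ n sorted divide complete =
  trans (cong (filter (_∣? n)) (applyUpTo≡interval _ 1 n λ _ → refl))
        (filter-interval (_∣? n) 1 n sorted (All.map ∣⇒1≤ divide) (All.map (s≤s ∘ ∣⇒≤) divide) divide
          λ _ _ → complete)

divisors-prime : ∀ {p} → Prime p → divisors p ≡ 1 ∷ p ∷ []
divisors-prime {p} p-prime =
  divisors≡ p {{prime⇒nonZero p-prime}} ((1<p ∷ []) ∷ [] ∷ []) (1∣ p ∷ ∣-refl ∷ []) complete
  where
  1<p = nonTrivial⇒n>1 p {{prime⇒nonTrivial p-prime}}
  complete : ∀ {d} → d ∣ p → d ∈ 1 ∷ p ∷ []
  complete d∣p with prime⇒irreducible p-prime d∣p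
  ... | inj₁ refl = here refl
  ... | inj₂ refl = there (here refl)

∣p*q⇒∈[1,p,q,p*q] : ∀ {p q d} → Prime p → Prime q → d ∣ p * q → d ∈ 1 ∷ p ∷ q ∷ p * q ∷ []
∣p*q⇒∈[1,p,q,p*q] {p} {q} {d} p-prime q-prime d∣pq with p ∣? d
... | no p∤d with prime⇒irreducible q-prime (coprime-divisor d⊥p d∣pq)
  where
  d⊥p : Coprime d p
  d⊥p (i∣d , i∣p) with prime⇒irreducible p-prime i∣p
  ... | inj₁ i≡1 = i≡1
  ... | inj₂ refl = contradiction i∣d p∤d
...   | inj₁ refl = here refl
...   | inj₂ refl = there (there (here refl))
∣p*q⇒∈[1,p,q,p*q] {p} {q} p-prime q-prime kp∣pq | yes (divides k refl)
  with prime⇒irreducible q-prime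
         (*-cancelˡ-∣ p {{prime⇒nonZero p-prime}} (subst (_∣ p * q) (ℕ.*-comm k p) kp∣pq))
... | inj₁ refl = there (here (ℕ.*-identityˡ p))
... | inj₂ refl = there (there (there (here (ℕ.*-comm q p))))

divisors-prime-product : ∀ {p q} → Prime p → Prime q → p < q →
                         divisors (p * q) ≡ 1 ∷ p ∷ q ∷ p * q ∷ []
divisors-prime-product {p} {q} p-prime q-prime p<q =
  divisors≡ (p * q) {{ℕ.m*n≢0 p q}}
    ((1<p ∷ 1<q ∷ ℕ.<-trans 1<q q<pq ∷ []) ∷ (p<q ∷ ℕ.<-trans p<q q<pq ∷ []) ∷ (q<pq ∷ []) ∷ [] ∷ [])
    (1∣ (p * q) ∷ m∣m*n q ∷ n∣m*n p ∷ ∣-refl ∷ [])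
    (∣p*q⇒∈[1,p,q,p*q] p-prime q-prime)
  where
  instance
    _ = prime⇒nonZero p-prime
    _ = prime⇒nonZero q-prime
  1<p = nonTrivial⇒n>1 p {{prime⇒nonTrivial p-prime}}
  1<q = nonTrivial⇒n>1 q {{prime⇒nonTrivial q-prime}}
  q<pq : q < p * q
  q<pq = subst (q <_) (ℕ.*-comm q p) (ℕ.m<m*n q p 1<p)

a*m≡l+b*[a∸n] : ∀ a b l m n → n ≤ a → a * b + l ≡ m * a + n * b → a * m ≡ l + b * (a ∸ n)
a*m≡l+b*[a∸n] a b l m n n≤a ab+l≡ = sym (ℕ.+-cancelʳ-≡ (b * n) _ _ (begin
  l + b * (a ∸ n) + b * n   ≡⟨ regroup l b (a ∸ n) n ⟩
  l + b * (a ∸ n + n)       ≡⟨ cong (λ c → l + b * c) (ℕ.m∸n+n≡m n≤a) ⟩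
  l + b * a                 ≡⟨ cong (l +_) (ℕ.*-comm b a) ⟩
  l + a * b                 ≡⟨ ℕ.+-comm l (a * b) ⟩
  a * b + l                 ≡⟨ ab+l≡ ⟩
  m * a + n * b             ≡⟨ cong₂ _+_ (ℕ.*-comm m a) (ℕ.*-comm n b) ⟩
  a * m + b * n             ∎))
  where
  open ≡-Reasoning
  regroup : ∀ l b s n → l + b * s + b * n ≡ l + b * (s + n)
  regroup = solve-∀

l+a*t+b*[a∸n]≡a*b : ∀ a b l t n → n ≤ a → b * n ≡ l + a * t → l + a * t + b * (a ∸ n) ≡ a * b
l+a*t+b*[a∸n]≡a*b a b l t n n≤a bn≡l+at = begin
  l + a * t + b * (a ∸ n)  ≡⟨ cong (_+ b * (a ∸ n)) bn≡l+at ⟨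
  b * n + b * (a ∸ n)      ≡⟨ ℕ.*-distribˡ-+ b n (a ∸ n) ⟨
  b * (n + (a ∸ n))        ≡⟨ cong (b *_) (ℕ.m+[n∸m]≡n n≤a) ⟩
  b * a                    ≡⟨ ℕ.*-comm b a ⟩
  a * b                    ∎
  where open ≡-Reasoning

cyclotomic-product : ∀ {Φ n ds} .{{_ : NonZero n}} → IsCyclotomicFamily Φ → divisors n ≡ ds →
                     productˢ (map coeff (map Φ ds)) ≗ Xˢ^ n -ˢ 1ˢ
cyclotomic-product {Φ} {n} cyclotomic refl = begin
  productˢ (map coeff (map Φ (divisors n)))  ≈⟨ coeff-prodₚ (map Φ (divisors n)) ⟨
  coeff (prodₚ (map Φ (divisors n)))         ≈⟨ cyclotomic n (>-nonZero⁻¹ n) ⟩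
  coeff (X^ n -ₚ oneₚ)                       ≈⟨ coeff--ₚ (X^ n) oneₚ ⟩
  coeff (X^ n) -ˢ coeff oneₚ                 ≈⟨ +ˢ-cong (coeff-X^ n) (-ˢ-cong coeff-oneₚ) ⟩
  Xˢ^ n -ˢ 1ˢ                                ∎
  where open ≗-Reasoning

Φpq-identity : ∀ {Φ p q} → IsCyclotomicFamily Φ → Prime p → Prime q → p < q →
  (Xˢ^ p -ˢ 1ˢ) *ˢ ((Xˢ^ q -ˢ 1ˢ) *ˢ coeff (Φ (p * q))) ≗ (Xˢ^ 1 -ˢ 1ˢ) *ˢ (Xˢ^ (p * q) -ˢ 1ˢ)
Φpq-identity {Φ} {p} {q} cyclotomic p-prime q-prime p<q = begin
  (Xˢ^ p -ˢ 1ˢ) *ˢ ((Xˢ^ q -ˢ 1ˢ) *ˢ φ (p * q))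
    ≈⟨ *ˢ-cong (product (divisors-prime p-prime)) (*ˢ-cong (product (divisors-prime q-prime)) ≗-refl) ⟨
  (φ 1 *ˢ (φ p *ˢ 1ˢ)) *ˢ ((φ 1 *ˢ (φ q *ˢ 1ˢ)) *ˢ φ (p * q))
    ≈⟨ solve 4 (λ a b c d → (a :* (b :* con 1ℤ)) :* ((a :* (c :* con 1ℤ)) :* d)
                         := (a :* con 1ℤ) :* (a :* (b :* (c :* (d :* con 1ℤ)))))
             ≗-refl (φ 1) (φ p) (φ q) (φ (p * q)) ⟩
  (φ 1 *ˢ 1ˢ) *ˢ (φ 1 *ˢ (φ p *ˢ (φ q *ˢ (φ (p * q) *ˢ 1ˢ))))
    ≈⟨ *ˢ-cong (product refl) (product {{ℕ.m*n≢0 p q}} (divisors-prime-product p-prime q-prime p<q)) ⟩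
  (Xˢ^ 1 -ˢ 1ˢ) *ˢ (Xˢ^ (p * q) -ˢ 1ˢ) ∎
  where
  open ≗-Reasoning
  instance
    _ = prime⇒nonZero p-prime
    _ = prime⇒nonZero q-prime
  φ : ℕ → Series
  φ d = coeff (Φ d)
  product : ∀ {n ds} .{{_ : NonZero n}} → divisors n ≡ ds → productˢ (map coeff (map Φ ds)) ≗ Xˢ^ n -ˢ 1ˢ
  product = cyclotomic-product cyclotomic

geom-Φpq-telescope : ∀ {Φ p q} → IsCyclotomicFamily Φ → Prime p → Prime q → p < q → ∀ l →
  (Xˢ^ p -ˢ 1ˢ) *ˢ ((Xˢ^ q -ˢ 1ˢ) *ˢ (geomˢ 1 l *ˢ coeff (Φ (p * q))))
    ≗ (Xˢ^ l -ˢ 1ˢ) *ˢ (Xˢ^ (p * q) -ˢ 1ˢ)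
geom-Φpq-telescope {Φ} {p} {q} cyclotomic p-prime q-prime p<q l = begin
  P *ˢ (Q *ˢ (geomˢ 1 l *ˢ F))
    ≈⟨ solve 4 (λ P Q A F → P :* (Q :* (A :* F)) := A :* (P :* (Q :* F))) ≗-refl P Q (geomˢ 1 l) F ⟩
  geomˢ 1 l *ˢ (P *ˢ (Q *ˢ F))
    ≈⟨ *ˢ-cong ≗-refl (Φpq-identity cyclotomic p-prime q-prime p<q) ⟩
  geomˢ 1 l *ˢ ((Xˢ^ 1 -ˢ 1ˢ) *ˢ (Xˢ^ (p * q) -ˢ 1ˢ))
    ≈⟨ solve 3 (λ A B C → A :* (B :* C) := (B :* A) :* C) ≗-refl (geomˢ 1 l) _ _ ⟩
  ((Xˢ^ 1 -ˢ 1ˢ) *ˢ geomˢ 1 l) *ˢ (Xˢ^ (p * q) -ˢ 1ˢ)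
    ≈⟨ *ˢ-cong (geom-telescope 1 l) ≗-refl ⟩
  (Xˢ^ (1 * l) -ˢ 1ˢ) *ˢ (Xˢ^ (p * q) -ˢ 1ˢ)
    ≡⟨ cong (λ n → (Xˢ^ n -ˢ 1ˢ) *ˢ (Xˢ^ (p * q) -ˢ 1ˢ)) (ℕ.*-identityˡ l) ⟩
  (Xˢ^ l -ˢ 1ˢ) *ˢ (Xˢ^ (p * q) -ˢ 1ˢ) ∎
  where
  open ≗-Reasoning
  P = Xˢ^ p -ˢ 1ˢ
  Q = Xˢ^ q -ˢ 1ˢ
  F = coeff (Φ (p * q))

geom-difference-telescope : ∀ a b l m n t s → a * m ≡ l + b * s → b * n ≡ l + a * t →
  (Xˢ^ a -ˢ 1ˢ) *ˢ ((Xˢ^ b -ˢ 1ˢ) *ˢ (geomˢ a m *ˢ geomˢ b n -ˢ Xˢ^ l *ˢ (geomˢ a t *ˢ geomˢ b s)))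
    ≗ (Xˢ^ l -ˢ 1ˢ) *ˢ (Xˢ^ (l + a * t + b * s) -ˢ 1ˢ)
geom-difference-telescope a b l m n t s am≡ bn≡ = begin
  A *ˢ (B *ˢ (geomˢ a m *ˢ geomˢ b n -ˢ Y *ˢ (geomˢ a t *ˢ geomˢ b s)))
    ≈⟨ solve 7 (λ A B g₁ g₂ y g₃ g₄ → A :* (B :* (g₁ :* g₂ :- y :* (g₃ :* g₄)))
                                    := (A :* g₁) :* (B :* g₂) :- y :* ((A :* g₃) :* (B :* g₄)))
             ≗-refl A B (geomˢ a m) (geomˢ b n) Y (geomˢ a t) (geomˢ b s) ⟩
  (A *ˢ geomˢ a m) *ˢ (B *ˢ geomˢ b n) -ˢ Y *ˢ ((A *ˢ geomˢ a t) *ˢ (B *ˢ geomˢ b s))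
    ≈⟨ +ˢ-cong (*ˢ-cong (geom-telescope a m) (geom-telescope b n))
               (-ˢ-cong (*ˢ-cong ≗-refl (*ˢ-cong (geom-telescope a t) (geom-telescope b s)))) ⟩
  (Xˢ^ (a * m) -ˢ 1ˢ) *ˢ (Xˢ^ (b * n) -ˢ 1ˢ) -ˢ Y *ˢ ((U -ˢ 1ˢ) *ˢ (V -ˢ 1ˢ))
    ≈⟨ +ˢ-cong (*ˢ-cong (+ˢ-cong (monomial l (b * s) am≡) ≗-refl)
                        (+ˢ-cong (monomial l (a * t) bn≡) ≗-refl)) ≗-refl ⟩
  (Y *ˢ V -ˢ 1ˢ) *ˢ (Y *ˢ U -ˢ 1ˢ) -ˢ Y *ˢ ((U -ˢ 1ˢ) *ˢ (V -ˢ 1ˢ))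
    ≈⟨ solve 3 (λ y u v → (y :* v :- con 1ℤ) :* (y :* u :- con 1ℤ)
                            :- y :* ((u :- con 1ℤ) :* (v :- con 1ℤ))
                        := (y :- con 1ℤ) :* (y :* u :* v :- con 1ℤ))
             ≗-refl Y U V ⟩
  (Y -ˢ 1ˢ) *ˢ (Y *ˢ U *ˢ V -ˢ 1ˢ)
    ≈⟨ *ˢ-cong ≗-refl (+ˢ-cong (*ˢ-cong (Xˢ^-+ l (a * t)) ≗-refl) ≗-refl) ⟨
  (Y -ˢ 1ˢ) *ˢ (Xˢ^ (l + a * t) *ˢ V -ˢ 1ˢ)
    ≈⟨ *ˢ-cong ≗-refl (+ˢ-cong (Xˢ^-+ (l + a * t) (b * s)) ≗-refl) ⟨
  (Y -ˢ 1ˢ) *ˢ (Xˢ^ (l + a * t + b * s) -ˢ 1ˢ) ∎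
  where
  open ≗-Reasoning
  A = Xˢ^ a -ˢ 1ˢ
  B = Xˢ^ b -ˢ 1ˢ
  Y = Xˢ^ l
  U = Xˢ^ (a * t)
  V = Xˢ^ (b * s)
  monomial : ∀ {e} c d → e ≡ c + d → Xˢ^ e ≗ Xˢ^ c *ˢ Xˢ^ d
  monomial c d refl = Xˢ^-+ c d

lemma8p2ˢ : ∀ {Φ p q l μ λ'} → IsCyclotomicFamily Φ → Prime p → Prime q → p < q →
  μ ≤ q → λ' ≤ p → p * q + l ≡ μ * p + λ' * q →
  geomˢ 1 l *ˢ coeff (Φ (p * q))
    ≗ geomˢ p μ *ˢ geomˢ q λ' -ˢ Xˢ^ l *ˢ (geomˢ p (q ∸ μ) *ˢ geomˢ q (p ∸ λ'))
lemma8p2ˢ {Φ} {p} {q} {l} {μ} {λ'} cyclotomic p-prime q-prime p<q μ≤q λ'≤p pq+l≡ =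
  Xˢ^-1-cancelˡ q (Xˢ^-1-cancelˡ p (begin
    (Xˢ^ p -ˢ 1ˢ) *ˢ ((Xˢ^ q -ˢ 1ˢ) *ˢ (geomˢ 1 l *ˢ coeff (Φ (p * q))))
      ≈⟨ geom-Φpq-telescope cyclotomic p-prime q-prime p<q l ⟩
    (Xˢ^ l -ˢ 1ˢ) *ˢ (Xˢ^ (p * q) -ˢ 1ˢ)
      ≡⟨ cong (λ e → (Xˢ^ l -ˢ 1ˢ) *ˢ (Xˢ^ e -ˢ 1ˢ)) pq≡l+pt+qs ⟩
    (Xˢ^ l -ˢ 1ˢ) *ˢ (Xˢ^ (l + p * t + q * s) -ˢ 1ˢ)
      ≈⟨ geom-difference-telescope p q l μ λ' t s pμ≡l+qs qλ'≡l+pt ⟨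
    (Xˢ^ p -ˢ 1ˢ) *ˢ ((Xˢ^ q -ˢ 1ˢ) *ˢ rhs) ∎))
  where
  open ≗-Reasoning
  instance
    _ = prime⇒nonZero p-prime
    _ = prime⇒nonZero q-prime
  t = q ∸ μ
  s = p ∸ λ'
  rhs = geomˢ p μ *ˢ geomˢ q λ' -ˢ Xˢ^ l *ˢ (geomˢ p t *ˢ geomˢ q s)
  pμ≡l+qs : p * μ ≡ l + q * s
  pμ≡l+qs = a*m≡l+b*[a∸n] p q l μ λ' λ'≤p pq+l≡
  qλ'≡l+pt : q * λ' ≡ l + p * t
  qλ'≡l+pt = a*m≡l+b*[a∸n] q p l λ' μ μ≤q
    (trans (cong (_+ l) (ℕ.*-comm q p)) (trans pq+l≡ (ℕ.+-comm (μ * p) (λ' * q))))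
  pq≡l+pt+qs : p * q ≡ l + p * t + q * s
  pq≡l+pt+qs = sym (l+a*t+b*[a∸n]≡a*b p q l t λ' λ'≤p qλ'≡l+pt)

lemma8p2 : (Φ : ℕ → Poly) → IsCyclotomicFamily Φ →
    (p q l μ λ' : ℕ) → Prime p → Prime q → p < q →
    1 ≤ l → l ≤ p + q ∸ 1 →
    1 ≤ μ → μ ≤ q → 1 ≤ λ' → λ' ≤ p →
    p * q + l ≡ μ * p + λ' * q →
    (geom 1 l *ₚ Φ (p * q))
      ≈ ((geom p μ *ₚ geom q λ')
         -ₚ (X^ l *ₚ (geom p (q ∸ μ) *ₚ geom q (p ∸ λ'))))
lemma8p2 Φ cyclotomic p q l μ λ' p-prime q-prime p<q _ _ _ μ≤q _ λ'≤p pq+l≡ = begin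
  coeff (geom 1 l *ₚ Φ (p * q))
    ≈⟨ coeff-*ₚ (geom 1 l) (Φ (p * q)) ⟩
  geomˢ 1 l *ˢ coeff (Φ (p * q))
    ≈⟨ lemma8p2ˢ cyclotomic p-prime q-prime p<q μ≤q λ'≤p pq+l≡ ⟩
  geomˢ p μ *ˢ geomˢ q λ' -ˢ Xˢ^ l *ˢ (geomˢ p t *ˢ geomˢ q s)
    ≈⟨ +ˢ-cong (coeff-*ₚ (geom p μ) (geom q λ'))
               (-ˢ-cong (≗-trans (coeff-*ₚ (X^ l) (geom p t *ₚ geom q s))
                                 (*ˢ-cong (coeff-X^ l) (coeff-*ₚ (geom p t) (geom q s))))) ⟨
  coeff (geom p μ *ₚ geom q λ') -ˢ coeff (X^ l *ₚ (geom p t *ₚ geom q s))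
    ≈⟨ coeff--ₚ (geom p μ *ₚ geom q λ') (X^ l *ₚ (geom p t *ₚ geom q s)) ⟨
  coeff ((geom p μ *ₚ geom q λ') -ₚ (X^ l *ₚ (geom p t *ₚ geom q s))) ∎
  where
  open ≗-Reasoning
  t = q ∸ μ
  s = p ∸ λ'
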